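{- Let $\mathbf{a}=(a_1,\ldots,a_k)$ be an integer partition with $\Delta(\mathbf{a})<0$. Then the graph $G(\mathbf{a})$ does not have a Hamilton cycle, and it does not have a Hamilton path unless $\mathbf{a}=(2,1)$.
   Context: An integer partition is a sequence $\mathbf{a}=(a_1,\ldots,a_k)$ of integers with $k\geq 2$ and $a_1\geq a_2\geq\cdots\geq a_k\geq 1$; write $n:=a_1+\cdots+a_k$. An $\mathbf{a}$-multiset permutation is a string of length $n$ over the alphabet $\{1,\ldots,k\}$ containing exactly $a_i$ occurrences of the symbol $i$ for each $i$. The graph $G(\mathbf{a})$ has as vertices all $\mathbf{a}$-multiset permutations, and two of them are adjacent if one is obtained from the other by a star transposition, i.e., by swapping the first entry with an entry at some position $2,\ldots,n$ that is distinct from the first entry. Define $\Delta(\mathbf{a}):=n-2a_1$. -}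

module Defs where

open import Data.Nat using (ℕ; zero; suc; _≤_; _≥_; _*_)
open import Data.Fin using (Fin; _≟_)
import Data.Fin as Fin
open import Data.List using (List; []; _∷_; length; lookup; filter; _[_]∷=_)
open import Data.Nat.ListAction using (sum)
open import Data.List.Relation.Unary.Linked using (Linked)
open import Data.List.Relation.Unary.Unique.Propositional using (Unique)
open import Data.List.Membership.Propositional using (_∈_)
open import Data.Integer using (ℤ; +_; _-_)
import Data.Maybe
open import Data.Product using (Σ; _×_; ∃; ∃-syntax)
open import Relation.Binary.PropositionalEquality using (_≡_; _≢_)

record IsPartition (a : List ℕ) : Set where
  field
    length≥2   : length a ≥ 2
    nonincr    : ∀ (i j : Fin (length a)) → i Fin.≤ j → lookup a j ≤ lookup a i
    positive   : ∀ (i : Fin (length a)) → 1 ≤ lookup a i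

size : List ℕ → ℕ
size a = sum a

-- a_1 (the first part; 0 for the empty list, irrelevant for partitions)
first : List ℕ → ℕ
first []      = 0
first (x ∷ _) = x

Δ : List ℕ → ℤ
Δ a = + size a - + (2 * first a)

-- Symbols: the alphabet {1,...,k} is represented by Fin k (symbol i+1 ↦ i).
Symbol : List ℕ → Set
Symbol a = Fin (length a)

occ : ∀ {k} → Fin k → List (Fin k) → ℕ
occ i xs = length (filter (_≟ i) xs)

-- an a-multiset permutation: exactly a_i occurrences of symbol i for each i
-- (its length is then automatically n)
IsMultisetPerm : (a : List ℕ) → List (Symbol a) → Set
IsMultisetPerm a xs = ∀ (i : Symbol a) → occ i xs ≡ lookup a i

-- star transposition: swap the first entry with an entry at a position
-- 2..n whose symbol differs from the first entry
StarAdj : ∀ {k} → List (Fin k) → List (Fin k) → Set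
StarAdj {k} xs ys =
  Σ (Fin k) λ x → Σ (List (Fin k)) λ rest → Σ (Fin (length rest)) λ j →
    (xs ≡ x ∷ rest) × (lookup rest j ≢ x) × (ys ≡ lookup rest j ∷ (rest [ j ]∷= x))

-- Edges of G(a): vertices are a-multiset permutations, adjacency = StarAdj
-- (StarAdj preserves multiset permutations and is symmetric).
Edge : (a : List ℕ) → List (Symbol a) → List (Symbol a) → Set
Edge a xs ys = IsMultisetPerm a xs × IsMultisetPerm a ys × StarAdj xs ys

record HamiltonPath (a : List ℕ) : Set where
  field
    path     : List (List (Symbol a))
    vertices : ∀ {v} → v ∈ path → IsMultisetPerm a v
    covers   : ∀ v → IsMultisetPerm a v → v ∈ path
    distinct : Unique path
    adjacent : Linked (Edge a) path

record HamiltonCycle (a : List ℕ) : Set where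
  field
    hpath    : HamiltonPath a
    first-v  : List (Symbol a)
    last-v   : List (Symbol a)
    rest-v   : List (List (Symbol a))
    shape    : HamiltonPath.path hpath ≡ first-v ∷ rest-v
    long     : length rest-v ≥ 2
    islast   : Data.List.last rest-v ≡ Data.Maybe.just last-v
    closing  : Edge a last-v first-v

{-# OPTIONS --safe #-}
module Submission where

-- Write 0 for the most frequent symbol; Δ(a) < 0 says that 0 occurs more often than all other
-- symbols together. A star transposition changes the first symbol, so no edge joins two words
-- starting with 0: these words form an independent set A, and a Hamilton cycle contains at most
-- as many of them as of the other words B, a Hamilton path at most one more.
-- On the other hand A is larger. In a word y w of B, read w as a bracket sequence in which the
-- non-zero symbols open and the 0s close; by the majority of 0, w has a first unmatched 0.
-- Moving that 0 to the front, y to its place, and reversing the segment in between gives a word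
-- of A, and the same rule with the roles of 0 and the non-zero symbols exchanged undoes it.
-- This injection B → A misses the sorted word, and when a₁ ≥ 3 also the sorted word with its
-- last 0 and first 1 transposed, so |A| ≥ |B| + 1, and |A| ≥ |B| + 2 unless a₁ ≤ 2, which
-- leaves only a = (2,1).

open import Defs
open import Data.Nat using (ℕ)
open import Data.List using (List; []; _∷_)
open import Data.Integer using (+_; _<_; _-_)
open import Data.Product using (_×_)
open import Relation.Nullary using (¬_)
open import Relation.Binary.PropositionalEquality using (_≢_)

open import Data.Bool using (Bool; true; false; not; T?)
open import Data.Bool.Properties using (T-≡; T-not-≡)
open import Data.Empty using (⊥-elim)
open import Data.Fin using (Fin; zero; suc; _≟_)
open import Data.Integer.Properties using (m-n≡m⊖n; ⊖-≥; drop‿+<+)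
open import Data.List
  using (_++_; _ʳ++_; _∷ʳ_; length; lookup; filter; filterᵇ; map; replicate; reverse; last)
open import Data.List.Properties using (length-++; length-map; length-replicate; length-removeAt′;
  filter-++; ʳ++-defn; ++-assoc; ∷-injectiveʳ)
open import Data.List.Membership.Propositional using (_∈_; _─_)
open import Data.List.Membership.Propositional.Properties using (∈-filter⁺; ∈-filter⁻; ∈-map⁻; ∈-++⁻)
open import Data.List.Relation.Binary.Disjoint.Propositional using (Disjoint)
open import Data.List.Relation.Binary.Permutation.Propositional
  using (_↭_; ↭-refl; ↭-trans; ↭-prep; ↭-swap; module PermutationReasoning)
open import Data.List.Relation.Binary.Permutation.Propositional.Properties
  using (↭-length; filter-↭; shift; ++↭ʳ++; ++⁺ˡ; ∷↭∷ʳ)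
open import Data.List.Relation.Binary.Subset.Propositional using (_⊆_)
open import Data.List.Relation.Unary.All as All using (All; []; _∷_)
import Data.List.Relation.Unary.All.Properties as All
open import Data.List.Relation.Unary.AllPairs using ([]; _∷_)
open import Data.List.Relation.Unary.Any using (here; there; index)
open import Data.List.Relation.Unary.Linked as Linked using (Linked; []; [-]; _∷_)
import Data.List.Relation.Unary.Linked.Properties as Linked
open import Data.List.Relation.Unary.Unique.Propositional using (Unique)
import Data.List.Relation.Unary.Unique.Propositional.Properties as Unique
open import Data.Maybe using (Maybe; just; nothing)
open import Data.Maybe.Relation.Binary.Connected using (Connected; just)
open import Data.Nat using (zero; suc; _+_; _*_; _≤_; s≤s; z≤n; _<?_)
  renaming (_<_ to _<ℕ_)
open import Data.Nat.Properties using (+-suc; +-identityʳ; ≤-pred; <⇒≤; ≤-trans; n<1+n; n≮0;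
  m≤n⇒m≤1+n; ≮⇒≥; +-monoʳ-≤; +-cancelˡ-<; 1+n≰n; module ≤-Reasoning)
open import Data.Product using (Σ; _,_; proj₁; proj₂)
open import Data.Sum using (inj₁; inj₂)
open import Function using (_∘_; Equivalence)
open import Relation.Nullary using (yes; no)
open import Relation.Binary.PropositionalEquality
  using (_≡_; refl; sym; trans; cong; cong₂; subst; subst₂; module ≡-Reasoning)

open Equivalence using (to; from)

∈-─⁺ : {A : Set} {x z : A} {ys : List A} → z ∈ ys → z ≢ x → (x∈ys : x ∈ ys) → z ∈ (ys ─ x∈ys)
∈-─⁺ (here refl)  z≢x (here refl)  = ⊥-elim (z≢x refl)
∈-─⁺ (here z≡y)   _   (there _)    = here z≡y
∈-─⁺ (there z∈ys) _   (here _)     = z∈ys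
∈-─⁺ (there z∈ys) z≢x (there x∈ys) = there (∈-─⁺ z∈ys z≢x x∈ys)

Unique-⊆⇒length≤ : {A : Set} {xs ys : List A} → Unique xs → xs ⊆ ys → length xs ≤ length ys
Unique-⊆⇒length≤ {xs = []}     _             _   = z≤n
Unique-⊆⇒length≤ {xs = x ∷ xs} {ys} (x∉xs ∷ uxs) sub =
  subst (suc (length xs) ≤_) (sym (length-removeAt′ ys (index x∈ys)))
    (s≤s (Unique-⊆⇒length≤ uxs λ z∈xs →
      ∈-─⁺ (sub (there z∈xs)) (λ z≡x → All.lookup x∉xs z∈xs (sym z≡x)) x∈ys))
  where
  x∈ys : x ∈ ys
  x∈ys = sub (here refl)

map⁺-leftInverse : {A B : Set} {f : A → B} (g : B → A) {xs : List A} →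
  All (λ x → g (f x) ≡ x) xs → Unique xs → Unique (map f xs)
map⁺-leftInverse g []            []           = []
map⁺-leftInverse g (gfx≡x ∷ inv) (x∉xs ∷ uxs) =
  All.map⁺ (All.zipWith (λ (x≢y , gfy≡y) fx≡fy → x≢y (trans (sym gfx≡x) (trans (cong g fx≡fy) gfy≡y)))
                        (x∉xs , inv))
  ∷ map⁺-leftInverse g inv uxs

∷-replicate-++-≢ : {A : Set} {x y : A} (m : ℕ) {t : List A} → x ≢ y →
  x ∷ replicate m x ++ y ∷ t ≢ replicate m x ++ y ∷ x ∷ t
∷-replicate-++-≢ zero    x≢y refl = x≢y refl
∷-replicate-++-≢ (suc m) x≢y eq   = ∷-replicate-++-≢ m x≢y (∷-injectiveʳ eq)

count : {A : Set} → (A → Bool) → List A → ℕ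
count p xs = length (filterᵇ p xs)

count-↭ : {A : Set} (p : A → Bool) {xs ys : List A} → xs ↭ ys → count p xs ≡ count p ys
count-↭ p xs↭ys = ↭-length (filter-↭ (T? ∘ p) xs↭ys)

-- Walks through an independent set

module _ {A : Set} {E : A → A → Set} (p : A → Bool)
         (independent : ∀ {x y} → E x y → p x ≡ true → p y ≡ false) where

  walk-count : ∀ {xs} → Linked E xs → count p xs ≤ suc (count (not ∘ p) xs)
  walk-count-outside : ∀ {x xs} → Linked E (x ∷ xs) → p x ≡ false →
                       count p (x ∷ xs) ≤ count (not ∘ p) (x ∷ xs)

  walk-count []                         = z≤n
  walk-count {x ∷ xs} walk with p x in px
  walk-count {x ∷ []}     _          | true  = s≤s z≤n
  walk-count {x ∷ y ∷ ys} (xy ∷ walk) | true  = s≤s (walk-count-outside walk (independent xy px))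
  walk-count {x ∷ xs}     walk       | false = m≤n⇒m≤1+n (walk-count (Linked.tail walk))

  walk-count-outside walk px rewrite px = walk-count (Linked.tail walk)

  closed-walk-count : ∀ {x xs l} → Linked E (x ∷ xs) → last xs ≡ just l → E l x →
                      count p (x ∷ xs) ≤ count (not ∘ p) (x ∷ xs)
  closed-walk-count {xs = []}     _                  ()     _
  closed-walk-count {x} {y ∷ ys} walk@(xy ∷ walk′) last≡l lx = from-head (p x) refl
    where
    rotation : x ∷ y ∷ ys ↭ (y ∷ ys) ∷ʳ x
    rotation = ∷↭∷ʳ x (y ∷ ys)
    -- the closing edge l → x lets the walk start at y and end at x
    rotated : Linked E ((y ∷ ys) ∷ʳ x)
    rotated = Linked.++⁺ walk′ (subst (λ m → Connected E m (just x)) (sym last≡l) (just lx)) [-]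
    from-head : ∀ b → p x ≡ b → count p (x ∷ y ∷ ys) ≤ count (not ∘ p) (x ∷ y ∷ ys)
    from-head false px = walk-count-outside walk px
    from-head true  px = subst₂ _≤_ (sym (count-↭ p rotation)) (sym (count-↭ (not ∘ p) rotation))
                           (walk-count-outside rotated (independent xy px))

-- Matching brackets

-- Scanning w with d pending openers, the first closer not matched by an earlier opener;
-- returns the scanned prefix reversed onto acc, the closer, and the rest of w.
firstUnmatched : {A : Set} → (A → Bool) → ℕ → List A → List A → Maybe (List A × A × List A)
firstUnmatched closes d acc []      = nothing
firstUnmatched closes d acc (x ∷ w) with closes x | d
... | false | _      = firstUnmatched closes (suc d) (x ∷ acc) w
... | true  | zero   = just (acc , x , w)
... | true  | suc d′ = firstUnmatched closes d′ (x ∷ acc) w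

splice : {A : Set} → A → Maybe (List A × A × List A) → List A
splice y (just (res , x , rest)) = x ∷ res ++ y ∷ rest
splice y nothing                 = []

-- junk value [] when the tail has no unmatched closer
exchange : {A : Set} → (A → Bool) → List A → List A
exchange closes []      = []
exchange closes (y ∷ w) = splice y (firstUnmatched closes 0 [] w)

module _ {A : Set} (closes : A → Bool) where

  firstUnmatched-opener : ∀ {x} d acc w → closes x ≡ false →
    firstUnmatched closes d acc (x ∷ w) ≡ firstUnmatched closes (suc d) (x ∷ acc) w
  firstUnmatched-opener d acc w cx rewrite cx = refl

  firstUnmatched-closer : ∀ {x} d acc w → closes x ≡ true →
    firstUnmatched closes (suc d) acc (x ∷ w) ≡ firstUnmatched closes d (x ∷ acc) w
  firstUnmatched-closer d acc w cx rewrite cx = refl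

  firstUnmatched-found : ∀ {x} acc w → closes x ≡ true →
    firstUnmatched closes 0 acc (x ∷ w) ≡ just (acc , x , w)
  firstUnmatched-found acc w cx rewrite cx = refl

module _ {A : Set} (closes : A → Bool) where

  data Fails : ℕ → List A → Set where
    []     : ∀ {d} → Fails d []
    opener : ∀ {d x w} → closes x ≡ false → Fails (suc d) w → Fails d (x ∷ w)
    closer : ∀ {d x w} → closes x ≡ true → Fails d w → Fails (suc d) (x ∷ w)

  firstUnmatched-fails : ∀ {d w} → Fails d w → ∀ acc → firstUnmatched closes d acc w ≡ nothing
  firstUnmatched-fails []                          acc = refl
  firstUnmatched-fails (opener {d} {w = w} cx fails) acc =
    trans (firstUnmatched-opener closes d acc w cx) (firstUnmatched-fails fails _)
  firstUnmatched-fails (closer {d} {w = w} cx fails) acc =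
    trans (firstUnmatched-closer closes d acc w cx) (firstUnmatched-fails fails _)

  fails-closers : ∀ {d w} → All (λ x → closes x ≡ true) w → length w ≤ d → Fails d w
  fails-closers []                        _         = []
  fails-closers {suc d} (cx ∷ cw) (s≤s w≤d) = closer cx (fails-closers cw w≤d)

  fails-openers : ∀ {x} m {d w} → closes x ≡ false → Fails (m + d) w → Fails d (replicate m x ++ w)
  fails-openers zero            cx fails = fails
  fails-openers (suc m) {d} {w} cx fails =
    opener cx (fails-openers m cx (subst (λ k → Fails k w) (sym (+-suc m d)) fails))

  exchange-fails : ∀ {y w} → Fails 0 w → exchange closes (y ∷ w) ≡ []
  exchange-fails {y} fails = cong (splice y) (firstUnmatched-fails fails [])

  -- the hypothesis says that d plus the number of openers in w is below the number of closers
  firstUnmatched-exists : ∀ d acc w → d + length w <ℕ count closes w + count closes w →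
    Σ (List A × A × List A) λ found → firstUnmatched closes d acc w ≡ just found
  firstUnmatched-exists d acc (y ∷ w) h with closes y | d
  ... | false | d′   = firstUnmatched-exists (suc d′) (y ∷ acc) w
    (subst (_<ℕ count closes w + count closes w) (+-suc d′ (length w)) h)
  ... | true  | zero = _ , refl
  ... | true  | suc d′ = firstUnmatched-exists d′ (y ∷ acc) w
    (≤-pred (subst₂ _≤_ (cong suc (+-suc d′ (length w))) (+-suc (count closes w) (count closes w))
                       (≤-pred h)))

  firstUnmatched-split : ∀ d acc w {res x rest} → firstUnmatched closes d acc w ≡ just (res , x , rest) →
    closes x ≡ true × acc ʳ++ w ≡ res ʳ++ x ∷ rest
  firstUnmatched-split d acc (y ∷ w) found with closes y in cy | d
  ... | false | d′     = firstUnmatched-split (suc d′) (y ∷ acc) w found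
  ... | true  | suc d′ = firstUnmatched-split d′ (y ∷ acc) w found
  firstUnmatched-split d acc (y ∷ w) refl | true | zero = cy , refl

  -- The scan with the roles of openers and closers exchanged passes over acc (which is read
  -- in reverse) without stopping, and leaves it with d more pending openers.
  ReverseScanSkips : ℕ → List A → Set
  ReverseScanSkips d acc = ∀ e z rest →
    firstUnmatched (not ∘ closes) (d + e) z (acc ++ rest) ≡ firstUnmatched (not ∘ closes) e (acc ʳ++ z) rest

  firstUnmatched-reverse : ∀ d acc w {res x rest} → firstUnmatched closes d acc w ≡ just (res , x , rest) →
    ReverseScanSkips d acc → ReverseScanSkips 0 res
  firstUnmatched-reverse d acc (y ∷ w) found skips with closes y in cy | d
  ... | false | d′ = firstUnmatched-reverse (suc d′) (y ∷ acc) w found λ e z rest →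
    trans (firstUnmatched-closer (not ∘ closes) (d′ + e) z (acc ++ rest) (cong not cy)) (skips e (y ∷ z) rest)
  ... | true | suc d′ = firstUnmatched-reverse d′ (y ∷ acc) w found λ e z rest →
    trans (firstUnmatched-opener (not ∘ closes) (d′ + e) z (acc ++ rest) (cong not cy)) (skips e (y ∷ z) rest)
  firstUnmatched-reverse d acc (y ∷ w) refl skips | true | zero = skips

  module Found {y : A} {w res : List A} {x : A} {rest : List A}
               (found : firstUnmatched closes 0 [] w ≡ just (res , x , rest)) where

    exchange-found : exchange closes (y ∷ w) ≡ x ∷ res ++ y ∷ rest
    exchange-found = cong (splice y) found

    exchange-closes : closes x ≡ true
    exchange-closes = proj₁ (firstUnmatched-split 0 [] w found)

    exchange-↭ : exchange closes (y ∷ w) ↭ y ∷ w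
    exchange-↭ rewrite exchange-found | proj₂ (firstUnmatched-split 0 [] w found) = begin
      x ∷ res ++ y ∷ rest  ↭⟨ ↭-prep x (shift y res rest) ⟩
      x ∷ y ∷ res ++ rest  ↭⟨ ↭-swap x y ↭-refl ⟩
      y ∷ x ∷ res ++ rest  ↭⟨ ↭-prep y (shift x res rest) ⟨
      y ∷ res ++ x ∷ rest  ↭⟨ ↭-prep y (++↭ʳ++ res (x ∷ rest)) ⟩
      y ∷ res ʳ++ x ∷ rest ∎
      where open PermutationReasoning

    exchange-inverse : closes y ≡ false → exchange (not ∘ closes) (exchange closes (y ∷ w)) ≡ y ∷ w
    exchange-inverse cy = begin
      exchange (not ∘ closes) (exchange closes (y ∷ w))
        ≡⟨ cong (exchange (not ∘ closes)) exchange-found ⟩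
      splice x (firstUnmatched (not ∘ closes) 0 [] (res ++ y ∷ rest))
        ≡⟨ cong (splice x) (trans (skips 0 [] (y ∷ rest))
                                  (firstUnmatched-found (not ∘ closes) _ rest (cong not cy))) ⟩
      y ∷ (res ʳ++ []) ++ x ∷ rest
        ≡⟨ cong (λ r → y ∷ r ++ x ∷ rest) (ʳ++-defn res) ⟩
      y ∷ (reverse res ++ []) ++ x ∷ rest
        ≡⟨ cong (y ∷_) (trans (++-assoc (reverse res) [] (x ∷ rest)) (sym (ʳ++-defn res))) ⟩
      y ∷ res ʳ++ x ∷ rest
        ≡⟨ cong (y ∷_) (proj₂ (firstUnmatched-split 0 [] w found)) ⟨
      y ∷ w ∎
      where
      open ≡-Reasoning
      skips : ReverseScanSkips 0 res
      skips = firstUnmatched-reverse 0 [] w found λ _ _ _ → refl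

-- Multiset permutations

occ-↭ : ∀ {k} (i : Fin k) {xs ys} → xs ↭ ys → occ i xs ≡ occ i ys
occ-↭ i xs↭ys = ↭-length (filter-↭ (_≟ i) xs↭ys)

IsMultisetPerm-resp-↭ : ∀ {a xs ys} → xs ↭ ys → IsMultisetPerm a ys → IsMultisetPerm a xs
IsMultisetPerm-resp-↭ xs↭ys perm i = trans (occ-↭ i xs↭ys) (perm i)

occ-++ : ∀ {k} (i : Fin k) xs ys → occ i (xs ++ ys) ≡ occ i xs + occ i ys
occ-++ i xs ys = trans (cong length (filter-++ (_≟ i) xs ys)) (length-++ (filter (_≟ i) xs))

occ-zero-replicate : ∀ {k} m → occ {suc k} zero (replicate m zero) ≡ m
occ-zero-replicate zero    = refl
occ-zero-replicate (suc m) = cong suc (occ-zero-replicate m)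

occ-suc-replicate : ∀ {k} (j : Fin k) m → occ (suc j) (replicate m zero) ≡ 0
occ-suc-replicate j zero    = refl
occ-suc-replicate j (suc m) = occ-suc-replicate j m

occ-zero-map-suc : ∀ {k} (xs : List (Fin k)) → occ zero (map suc xs) ≡ 0
occ-zero-map-suc []       = refl
occ-zero-map-suc (x ∷ xs) = occ-zero-map-suc xs

occ-suc-map-suc : ∀ {k} (j : Fin k) xs → occ (suc j) (map suc xs) ≡ occ j xs
occ-suc-map-suc j []       = refl
occ-suc-map-suc j (x ∷ xs) with x ≟ j
... | yes _ = cong suc (occ-suc-map-suc j xs)
... | no  _ = occ-suc-map-suc j xs

isZero : ∀ {k} → Fin k → Bool
isZero zero    = true
isZero (suc _) = false

count-isZero : ∀ {k} (xs : List (Fin (suc k))) → count isZero xs ≡ occ zero xs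
count-isZero []           = refl
count-isZero (zero  ∷ xs) = cong suc (count-isZero xs)
count-isZero (suc _ ∷ xs) = count-isZero xs

dropZeros : ∀ {k} → List (Fin (suc k)) → List (Fin k)
dropZeros []           = []
dropZeros (zero  ∷ xs) = dropZeros xs
dropZeros (suc x ∷ xs) = x ∷ dropZeros xs

occ-dropZeros : ∀ {k} (j : Fin k) xs → occ j (dropZeros xs) ≡ occ (suc j) xs
occ-dropZeros j []           = refl
occ-dropZeros j (zero  ∷ xs) = occ-dropZeros j xs
occ-dropZeros j (suc x ∷ xs) with x ≟ j
... | yes _ = cong suc (occ-dropZeros j xs)
... | no  _ = occ-dropZeros j xs

length-dropZeros : ∀ {k} (xs : List (Fin (suc k))) → length xs ≡ occ zero xs + length (dropZeros xs)
length-dropZeros []           = refl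
length-dropZeros (zero  ∷ xs) = cong suc (length-dropZeros xs)
length-dropZeros (suc x ∷ xs) = trans (cong suc (length-dropZeros xs)) (sym (+-suc _ _))

length-multisetPerm : ∀ a {xs} → IsMultisetPerm a xs → length xs ≡ size a
length-multisetPerm []      {[]}    _    = refl
length-multisetPerm (m ∷ a) {xs}    perm = trans (length-dropZeros xs)
  (cong₂ _+_ (perm zero)
             (length-multisetPerm a {dropZeros xs} λ j → trans (occ-dropZeros j xs) (perm (suc j))))

canonical : (a : List ℕ) → List (Symbol a)
canonical []      = []
canonical (m ∷ a) = replicate m zero ++ map suc (canonical a)

canonical-perm : ∀ a → IsMultisetPerm a (canonical a)
canonical-perm (m ∷ a) zero = begin
  occ zero (replicate m zero ++ map suc (canonical a))
    ≡⟨ occ-++ zero (replicate m zero) _ ⟩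
  occ zero (replicate m zero) + occ zero (map suc (canonical a))
    ≡⟨ cong₂ _+_ (occ-zero-replicate m) (occ-zero-map-suc (canonical a)) ⟩
  m + 0
    ≡⟨ +-identityʳ m ⟩
  m ∎
  where open ≡-Reasoning
canonical-perm (m ∷ a) (suc j) = begin
  occ (suc j) (replicate m zero ++ map suc (canonical a))
    ≡⟨ occ-++ (suc j) (replicate m zero) _ ⟩
  occ (suc j) (replicate m zero) + occ (suc j) (map suc (canonical a))
    ≡⟨ cong₂ _+_ (occ-suc-replicate j m) (occ-suc-map-suc j (canonical a)) ⟩
  occ j (canonical a)
    ≡⟨ canonical-perm a j ⟩
  lookup (m ∷ a) (suc j) ∎
  where open ≡-Reasoning

length-canonical : ∀ a → length (canonical a) ≡ size a
length-canonical a = length-multisetPerm a {canonical a} (canonical-perm a)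

-- Words starting with the most frequent symbol

-- [] counts as starting with 0, so that every word outside the class has a head.
startsWithZero : ∀ {k} → List (Fin k) → Bool
startsWithZero []      = true
startsWithZero (x ∷ _) = isZero x

StarAdj-leavesZero : ∀ {k} {xs ys : List (Fin k)} → StarAdj xs ys →
  startsWithZero xs ≡ true → startsWithZero ys ≡ false
StarAdj-leavesZero (x , rest , j , refl , y≢x , refl) = isZero-≢ y≢x
  where
  isZero-≢ : ∀ {k} {x y : Fin k} → y ≢ x → isZero x ≡ true → isZero y ≡ false
  isZero-≢ {x = zero} {zero}  y≢x _ = ⊥-elim (y≢x refl)
  isZero-≢ {x = zero} {suc _} _   _ = refl

Edge-leavesZero : ∀ {a u v} → Edge a u v → startsWithZero u ≡ true → startsWithZero v ≡ false
Edge-leavesZero (_ , _ , adj) = StarAdj-leavesZero adj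

-- More words start with 0 than not

module _ {a₁ : ℕ} {r : List ℕ} (majority : size r <ℕ a₁) where

  exchange-minority : ∀ {y w} → IsMultisetPerm (a₁ ∷ r) (suc y ∷ w) →
    Σ _ λ found → firstUnmatched isZero 0 [] w ≡ just found
  exchange-minority {y} {w} perm = firstUnmatched-exists isZero 0 [] w (begin-strict
    length w                        <⟨ n<1+n (length w) ⟩
    suc (length w)                  ≡⟨ length-multisetPerm (a₁ ∷ r) {suc y ∷ w} perm ⟩
    a₁ + size r                     ≤⟨ +-monoʳ-≤ a₁ (<⇒≤ majority) ⟩
    a₁ + a₁                         ≡⟨ cong₂ _+_ zeros zeros ⟨
    count isZero w + count isZero w ∎)
    where
    open ≤-Reasoning
    zeros : count isZero w ≡ a₁
    zeros = trans (count-isZero w) (perm zero)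

  record Exchanged (v : List (Symbol (a₁ ∷ r))) : Set where
    field
      vertex   : IsMultisetPerm (a₁ ∷ r) (exchange isZero v)
      headZero : startsWithZero (exchange isZero v) ≡ true
      inverse  : exchange (not ∘ isZero) (exchange isZero v) ≡ v

  exchanged : ∀ {v} → IsMultisetPerm (a₁ ∷ r) v → startsWithZero v ≡ false → Exchanged v
  exchanged {suc y ∷ w} perm _ with exchange-minority perm
  ... | _ , found = record
    { vertex   = IsMultisetPerm-resp-↭ exchange-↭ perm
    ; headZero = trans (cong startsWithZero exchange-found) exchange-closes
    ; inverse  = exchange-inverse refl
    }
    where open Found isZero {suc y} {w} found

record Unpaired (a : List ℕ) (e : List (Symbol a)) : Set where
  field
    vertex   : IsMultisetPerm a e
    headZero : startsWithZero e ≡ true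
    rejected : exchange (not ∘ isZero) e ≡ []

count-zeroHeaded : ∀ {a₁ r} → size r <ℕ a₁ → (hp : HamiltonPath (a₁ ∷ r)) → ∀ {es} →
  Unique es → All (Unpaired (a₁ ∷ r)) es →
  length es + count (not ∘ startsWithZero) (HamiltonPath.path hp)
    ≤ count startsWithZero (HamiltonPath.path hp)
count-zeroHeaded {a₁} {r} majority hp {es} unique-es unpaired = begin
  length es + count (not ∘ startsWithZero) P
    ≡⟨ cong (_+_ (length es)) (length-map (exchange isZero) others) ⟨
  length es + length (map (exchange isZero) others)
    ≡⟨ length-++ es ⟨
  length (es ++ map (exchange isZero) others)
    ≤⟨ Unique-⊆⇒length≤ unique included ⟩
  count startsWithZero P ∎
  where
  open ≤-Reasoning
  open HamiltonPath hp renaming (path to P)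
  others : List (List (Symbol (a₁ ∷ r)))
  others = filterᵇ (not ∘ startsWithZero) P
  other : ∀ {v} → v ∈ others → v ∈ P × startsWithZero v ≡ false
  other v∈ = let (v∈P , notZero) = ∈-filter⁻ (T? ∘ (not ∘ startsWithZero)) v∈ in v∈P , to T-not-≡ notZero
  facts : ∀ {v} → v ∈ others → Exchanged majority v
  facts v∈ = exchanged majority (vertices (proj₁ (other v∈))) (proj₂ (other v∈))
  disjoint : Disjoint es (map (exchange isZero) others)
  disjoint (e∈es , e∈img) with ∈-map⁻ (exchange isZero) e∈img
  ... | v , v∈ , refl = nonempty (proj₂ (other v∈))
      (trans (sym (Exchanged.inverse (facts v∈))) (Unpaired.rejected (All.lookup unpaired e∈es)))
    where
    nonempty : ∀ {v} → startsWithZero v ≡ false → v ≢ []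
    nonempty () refl
  unique : Unique (es ++ map (exchange isZero) others)
  unique = Unique.++⁺ unique-es
    (map⁺-leftInverse (exchange (not ∘ isZero)) (All.tabulate (Exchanged.inverse ∘ facts))
                      (Unique.filter⁺ (T? ∘ (not ∘ startsWithZero)) distinct))
    disjoint
  zeroHeaded : ∀ {v} → IsMultisetPerm (a₁ ∷ r) v → startsWithZero v ≡ true → v ∈ filterᵇ startsWithZero P
  zeroHeaded perm z = ∈-filter⁺ (T? ∘ startsWithZero) (covers _ perm) (from T-≡ z)
  included : (es ++ map (exchange isZero) others) ⊆ filterᵇ startsWithZero P
  included e∈ with ∈-++⁻ es e∈
  ... | inj₁ e∈es = zeroHeaded (Unpaired.vertex (All.lookup unpaired e∈es))
                               (Unpaired.headZero (All.lookup unpaired e∈es))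
  ... | inj₂ e∈img with ∈-map⁻ (exchange isZero) e∈img
  ...   | v , v∈ , refl = zeroHeaded (Exchanged.vertex (facts v∈)) (Exchanged.headZero (facts v∈))

nonzeros : ∀ {k} (xs : List (Fin k)) → All (λ x → not (isZero x) ≡ true) (map suc xs)
nonzeros xs = All.map⁺ (All.universal (λ _ → refl) xs)

canonical-unpaired : ∀ {a₁ r} → size r ≤ a₁ → Unpaired (suc a₁ ∷ r) (canonical (suc a₁ ∷ r))
canonical-unpaired {a₁} {r} r≤a₁ = record
  { vertex   = canonical-perm (suc a₁ ∷ r)
  ; headZero = refl
  ; rejected = exchange-fails (not ∘ isZero) (fails-openers (not ∘ isZero) a₁ refl
      (fails-closers (not ∘ isZero) (nonzeros (canonical r))
                     (subst₂ _≤_ length≡ (sym (+-identityʳ a₁)) r≤a₁)))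
  }
  where
  length≡ : size r ≡ length (map suc (canonical r))
  length≡ = sym (trans (length-map suc (canonical r)) (length-canonical r))

-- the sorted word 0 0 0 0ᵐ 1 t with its last 0 and first 1 transposed
transposeLastZero : ∀ {k} → ℕ → List (Fin (suc (suc k))) → List (Fin (suc (suc k)))
transposeLastZero m t = zero ∷ zero ∷ replicate m zero ++ suc zero ∷ zero ∷ t

transposeLastZero-↭ : ∀ {k} m (t : List (Fin (suc (suc k)))) →
  transposeLastZero m t ↭ zero ∷ zero ∷ zero ∷ replicate m zero ++ suc zero ∷ t
transposeLastZero-↭ m t = ↭-prep zero (↭-prep zero (↭-trans
  (++⁺ˡ (replicate m zero) (↭-swap (suc zero) zero ↭-refl)) (shift zero (replicate m zero) (suc zero ∷ t))))

transposeLastZero-≢ : ∀ {k} m (t : List (Fin (suc (suc k)))) →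
  zero ∷ zero ∷ zero ∷ replicate m zero ++ suc zero ∷ t ≢ transposeLastZero m t
transposeLastZero-≢ m t eq = ∷-replicate-++-≢ m (λ ()) (∷-injectiveʳ (∷-injectiveʳ eq))

transposeLastZero-fails : ∀ {k} m {t : List (Fin (suc (suc k)))} →
  All (λ x → not (isZero x) ≡ true) t → length t ≤ suc m →
  exchange (not ∘ isZero) (transposeLastZero m t) ≡ []
transposeLastZero-fails m {t} nonzero t≤ = exchange-fails (not ∘ isZero)
  (fails-openers (not ∘ isZero) (suc m) refl (closer refl (opener refl
    (fails-closers (not ∘ isZero) nonzero (subst (length t ≤_) (cong suc (sym (+-identityʳ m))) t≤)))))

-- Hamilton cycles and paths

no-HamiltonCycle : ∀ {a₁ r} → size r <ℕ a₁ → ¬ HamiltonCycle (a₁ ∷ r)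
no-HamiltonCycle {suc a₁} {r} majority hc = 1+n≰n (≤-trans surplus alternation)
  where
  open HamiltonCycle hc
  P : List (List (Symbol (suc a₁ ∷ r)))
  P = HamiltonPath.path hpath
  surplus : 1 + count (not ∘ startsWithZero) P ≤ count startsWithZero P
  surplus = count-zeroHeaded majority hpath ([] ∷ []) (canonical-unpaired (≤-pred majority) ∷ [])
  alternation : count startsWithZero P ≤ count (not ∘ startsWithZero) P
  alternation rewrite shape =
    closed-walk-count startsWithZero Edge-leavesZero (subst (Linked _) shape (HamiltonPath.adjacent hpath))
                      islast closing

no-HamiltonPath : ∀ {a₁ a₂ r} → 3 ≤ a₁ → 1 ≤ a₂ → size (a₂ ∷ r) <ℕ a₁ → ¬ HamiltonPath (a₁ ∷ a₂ ∷ r)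
no-HamiltonPath {suc (suc (suc m))} {suc x} {r} (s≤s (s≤s (s≤s _))) (s≤s _) majority hp =
  1+n≰n (≤-trans surplus alternation)
  where
  -- canonical (a₁ ∷ a₂ ∷ r) unfolds to 0 0 0 0ᵐ 1 t
  t : List (Fin (suc (suc (length r))))
  t = map suc (replicate x zero ++ map suc (canonical r))
  length-t : length t ≡ x + size r
  length-t = begin
    length t                                            ≡⟨ length-map suc (replicate x zero ++ _) ⟩
    length (replicate x zero ++ map suc (canonical r))  ≡⟨ length-++ (replicate x zero) ⟩
    length (replicate x zero) + length (map suc (canonical r))
      ≡⟨ cong₂ _+_ (length-replicate x) (trans (length-map suc (canonical r)) (length-canonical r)) ⟩
    x + size r                                          ∎
    where open ≡-Reasoning
  second : Unpaired (suc (suc (suc m)) ∷ suc x ∷ r) (transposeLastZero m t)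
  second = record
    { vertex   = IsMultisetPerm-resp-↭ (transposeLastZero-↭ m t) (canonical-perm _)
    ; headZero = refl
    ; rejected = transposeLastZero-fails m (nonzeros _)
                   (subst (_≤ suc m) (sym length-t) (≤-pred (≤-pred majority)))
    }
  P : List (List (Symbol (suc (suc (suc m)) ∷ suc x ∷ r)))
  P = HamiltonPath.path hp
  surplus : 2 + count (not ∘ startsWithZero) P ≤ count startsWithZero P
  surplus = count-zeroHeaded majority hp ((transposeLastZero-≢ m t ∷ []) ∷ [] ∷ [])
    (canonical-unpaired (≤-pred majority) ∷ second ∷ [])
  alternation : count startsWithZero P ≤ suc (count (not ∘ startsWithZero) P)
  alternation = walk-count startsWithZero Edge-leavesZero (HamiltonPath.adjacent hp)

m-n<0⇒m<n : ∀ m n → + m - + n < + 0 → m <ℕ n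
m-n<0⇒m<n m n m-n<0 with m <? n
... | yes m<n = m<n
... | no  m≮n = ⊥-elim (n≮0 (drop‿+<+ (subst (_< + 0) (trans (m-n≡m⊖n m n) (⊖-≥ (≮⇒≥ m≮n))) m-n<0)))

Δ<0⇒majority : ∀ a₁ r → Δ (a₁ ∷ r) < + 0 → size r <ℕ a₁
Δ<0⇒majority a₁ r Δ<0 = +-cancelˡ-< a₁ (size r) a₁
  (subst (a₁ + size r <ℕ_) (cong (_+_ a₁) (+-identityʳ a₁)) (m-n<0⇒m<n (a₁ + size r) (2 * a₁) Δ<0))

three≤a₁ : ∀ {a₁ a₂ r} → IsPartition (a₁ ∷ a₂ ∷ r) → size (a₂ ∷ r) <ℕ a₁ →
  _≢_ {A = List ℕ} (a₁ ∷ a₂ ∷ r) (2 ∷ 1 ∷ []) → 3 ≤ a₁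
three≤a₁ {suc (suc (suc _))}                     _  _              _    = s≤s (s≤s (s≤s z≤n))
three≤a₁ {a₂ = zero}                             ip _              _
  with () ← IsPartition.positive ip (suc zero)
three≤a₁ {suc zero}       {suc _}                _  (s≤s ())       _
three≤a₁ {suc (suc zero)} {suc (suc _)}          _  (s≤s (s≤s ())) _
three≤a₁ {suc (suc zero)} {suc zero} {[]}        _  _              a≢21 = ⊥-elim (a≢21 refl)
three≤a₁ {suc (suc zero)} {suc zero} {suc _ ∷ _} _  (s≤s (s≤s ())) _
three≤a₁ {suc (suc zero)} {suc zero} {zero ∷ _}  ip _              _
  with () ← IsPartition.positive ip (suc (suc zero))

theorem4 : (a : List ℕ) → IsPartition a → Δ a < + 0 →
    ¬ HamiltonCycle a × (a ≢ 2 ∷ 1 ∷ [] → ¬ HamiltonPath a)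
theorem4 []                ip  _   with () ← IsPartition.length≥2 ip
theorem4 (_ ∷ [])          ip  _   with s≤s () ← IsPartition.length≥2 ip
theorem4 (a₁ ∷ a₂ ∷ r)     ip  Δ<0 =
  no-HamiltonCycle majority ,
  λ a≢21 → no-HamiltonPath (three≤a₁ ip majority a≢21) (IsPartition.positive ip (suc zero)) majority
  where
  majority : size (a₂ ∷ r) <ℕ a₁
  majority = Δ<0⇒majority a₁ (a₂ ∷ r) Δ<0
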